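{- Let $X$ and $J$ be finite sets and let ${\cal K}=(S;J;({\cal P}^j\mid j\in J);X;\psi)$ be a Kripke structure. Suppose $S$ carries a topology (not necessarily the one induced by the formulas) such that (1) for every $a\in\{0,1\}^X$ the set $\psi^{ -1}(a)$ is clopen (closed and open) in $S$, and (2) for every $j\in J$ the partition ${\cal P}^j$ is both upper and lower hemi-continuous. Then the canonical map $\phi^{\cal K}:S\to\Omega(X,J)$ is continuous, where $\Omega(X,J)$ carries the topology induced by the formulas.
   Context: A Kripke structure ${\cal K}=(S;J;({\cal P}^j\mid j\in J);X;\psi)$ consists of a set $S$, a set $J$ of persons, a partition ${\cal P}^j$ of $S$ for each $j\in J$, a set $X$ of primitive propositions, and a function $\psi:S\to\{0,1\}^X$; write $\psi^x(s)$ for the $x$-coordinate of $\psi(s)$. Formulas ${\cal L}(X,J)$ are built inductively: each $x\in X$ is a formula; if $g,h$ are formulas then so are $\neg g$, $g\wedge h$, and $k_j g$ for each $j\in J$; nothing else is a formula. For a Kripke structure ${\cal K}$ define $\alpha^{\cal K}:{\cal L}(X,J)\to 2^S$ inductively: $\alpha^{\cal K}(x)=\{s:\psi^x(s)=1\}$; $\alpha^{\cal K}(\neg g)=S\setminus\alpha^{\cal K}(g)$; $\alpha^{\cal K}(g\wedge h)=\alpha^{\cal K}(g)\cap\alpha^{\cal K}(h)$; $\alpha^{\cal K}(k_j g)=\{s: s\in P\in{\cal P}^j\Rightarrow P\subseteq\alpha^{\cal K}(g)\}$. $\Omega(X,J)$ is the set of all complete and consistent subsets of ${\cal L}(X,J)$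 with respect to the multi-agent S5 logic (axioms: all substitution instances of propositional tautologies, $(k_jf\wedge k_j(f\to g))\to k_jg$, $k_jf\to f$, $k_jf\to k_jk_jf$, $\neg k_jf\to k_j\neg k_jf$; rules: modus ponens and necessitation $f\vdash k_jf$). A set is complete if it contains $f$ or $\neg f$ for every formula $f$, consistent if no finite subset derives a contradiction. The canonical map is $\phi^{\cal K}(s)=\{f\in{\cal L}(X,J): s\in\alpha^{\cal K}(f)\}$. The topology induced by the formulas on $\Omega(X,J)$ has as base the sets $\{z\in\Omega(X,J): f\in z\}$, $f\in{\cal L}(X,J)$. A partition ${\cal P}$ of a topological space $D$ is upper (resp. lower) hemi-continuous if the correspondence $d\mapsto P(d)$, sending $d$ to the member of ${\cal P}$ containing $d$, is upper (resp. lower) hemi-continuous: upper means for every $d$ and open $U\supseteq P(d)$ there is a neighborhood $V$ of $d$ with $P(d')\subseteq U$ for all $d'\in V$; lower means for every $d$ and open $U$ with $U\cap P(d)\neq\emptyset$ there is a neighborhood $V$ of $d$ with $P(d')\cap U\neq\emptyset$ for all $d'\in V$. -}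

module Defs where

open import Level using (0ℓ)
open import Data.Nat using (ℕ)
open import Data.Fin using (Fin)
open import Data.Bool using (Bool; true; false; not; _∧_)
open import Data.List using (List; []; _∷_)
open import Data.List.Relation.Unary.All using (All)
open import Data.Product using (Σ; _×_; _,_; proj₁)
open import Data.Empty using (⊥)
open import Data.Sum using (_⊎_)
open import Data.Unit using (⊤)
open import Function.Bundles using (_⇔_)
open import Relation.Nullary using (¬_)
open import Relation.Binary.PropositionalEquality using (_≡_)
open import Relation.Binary.Structures using (IsEquivalence)

Subset : Set → Set₁
Subset S = S → Set

record Topology (S : Set) : Set₁ where
  field
    Open      : Subset S → Set
    open-ext  : ∀ {U V : Subset S} → Open U → (∀ s → U s ⇔ V s) → Open V
    open-univ : Open (λ _ → ⊤)
    open-∩    : ∀ {U V : Subset S} → Open U → Open V → Open (λ s → U s × V s)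
    open-⋃    : ∀ {I : Set} (U : I → Subset S) → (∀ i → Open (U i)) →
                Open (λ s → Σ I λ i → U i s)

module _ {S : Set} (τ : Topology S) where
  open Topology τ

  Closed : Subset S → Set
  Closed A = Open (λ s → ¬ A s)

  Clopen : Subset S → Set
  Clopen A = Open A × Closed A

  -- A partition of S, given as the equivalence relation "same block";
  -- the block containing d is P(d) = { e | d ~ e }.
  -- Upper hemi-continuity of d ↦ P(d).
  UpperHemiContinuous : (_~_ : S → S → Set) → Set₁
  UpperHemiContinuous _~_ =
    ∀ (d : S) (U : Subset S) → Open U → (∀ e → d ~ e → U e) →
    Σ (Subset S) λ V → Open V × V d × (∀ d' → V d' → ∀ e → d' ~ e → U e)

  LowerHemiContinuous : (_~_ : S → S → Set) → Set₁
  LowerHemiContinuous _~_ =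
    ∀ (d : S) (U : Subset S) → Open U → (Σ S λ e → d ~ e × U e) →
    Σ (Subset S) λ V → Open V × V d × (∀ d' → V d' → Σ S λ e → d' ~ e × U e)

-- Kripke structures with X = Fin n, J = Fin m

record Kripke (n m : ℕ) : Set₁ where
  field
    S     : Set
    _∼[_]_ : S → Fin m → S → Set          -- partition 𝒫^j as "same block"
    isEq  : ∀ j → IsEquivalence (λ s t → s ∼[ j ] t)
    ψ     : S → (Fin n → Bool)

data Formula (n m : ℕ) : Set where
  var  : Fin n → Formula n m
  neg  : Formula n m → Formula n m
  _and_ : Formula n m → Formula n m → Formula n m
  K    : Fin m → Formula n m → Formula n m

module _ {n m : ℕ} where

  _⇒_ : Formula n m → Formula n m → Formula n m
  f ⇒ g = neg (f and neg g)

  tval : (Formula n m → Bool) → Formula n m → Bool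
  tval v (var x)   = v (var x)
  tval v (neg f)   = not (tval v f)
  tval v (f and g) = tval v f ∧ tval v g
  tval v (K j f)   = v (K j f)

  -- substitution instances of propositional tautologies
  Tautology : Formula n m → Set
  Tautology f = ∀ (v : Formula n m → Bool) → tval v f ≡ true

  data ⊢_ : Formula n m → Set where
    taut : ∀ {f} → Tautology f → ⊢ f
    axK  : ∀ {j f g} → ⊢ ((K j f and K j (f ⇒ g)) ⇒ K j g)
    axT  : ∀ {j f} → ⊢ (K j f ⇒ f)
    ax4  : ∀ {j f} → ⊢ (K j f ⇒ K j (K j f))
    ax5  : ∀ {j f} → ⊢ (neg (K j f) ⇒ K j (neg (K j f)))
    mp   : ∀ {f g} → ⊢ f → ⊢ (f ⇒ g) → ⊢ g
    nec  : ∀ {j f} → ⊢ f → ⊢ K j f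

  conj : Formula n m → List (Formula n m) → Formula n m
  conj f []       = f
  conj f (g ∷ gs) = f and conj g gs

  Complete : (Formula n m → Set) → Set
  Complete z = ∀ f → z f ⊎ z (neg f)

  -- no finite (nonempty) subset derives a contradiction
  Consistent : (Formula n m → Set) → Set
  Consistent z = ∀ f fs → z f → All z fs → ¬ (⊢ neg (conj f fs))

Ω : ℕ → ℕ → Set₁
Ω n m = Σ (Formula n m → Set) λ z → Complete z × Consistent z

-- open sets of the topology generated by the base { z | f ∈ z }
OpenΩ : ∀ {n m} → (Ω n m → Set) → Set₁
OpenΩ {n} {m} U =
  ∀ z → U z → Σ (Formula n m) λ f → proj₁ z f × (∀ w → proj₁ w f → U w)

module _ {n m : ℕ} (𝒦 : Kripke n m) where
  open Kripke 𝒦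

  α : Formula n m → Subset S
  α (var x)   s = ψ s x ≡ true
  α (neg f)   s = ¬ α f s
  α (f and g) s = α f s × α g s
  α (K j f)   s = ∀ t → s ∼[ j ] t → α f t

  ψ⁻¹ : (Fin n → Bool) → Subset S
  ψ⁻¹ a s = ∀ x → ψ s x ≡ a x

  IsCanonicalMap : (S → Ω n m) → Set
  IsCanonicalMap φ = ∀ s f → proj₁ (φ s) f ⇔ α f s

  Continuous : Topology S → (S → Ω n m) → Set₁
  Continuous τ φ = ∀ (U : Ω n m → Set) → OpenΩ U → Topology.Open τ (λ s → U (φ s))

-- The topology on Ω(X,J) has the basic open sets {z | f ∈ z}, and the
-- preimage of such a set under φ is the truth set α(f).  So φ is continuous
-- as soon as every truth set α(f) is open in S.  We prove the stronger,
-- inductive statement that every α(f) is CLOPEN: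
--   * α(x) is a union of fibres ψ⁻¹(a), and so is its complement;
--   * clopen sets are closed under complement and (classically) intersection;
--   * α(k_j f) is the "box" {d | P(d) ⊆ α(f)}, open by upper hemi-continuity,
--     and its complement is the "diamond" {d | P(d) ∩ (S∖α(f)) ≠ ∅}, open by
--     lower hemi-continuity.
module Submission where

open import Defs
open import Level using (0ℓ)
open import Data.Nat using (ℕ)
open import Data.Fin using (Fin)
open import Data.Bool using (Bool; true; false; not; _∧_)
open import Data.Product using (Σ; _×_; _,_; proj₁; proj₂)
open import Data.Sum using (_⊎_; inj₁; inj₂)
open import Data.List using ([]; _∷_)
open import Data.List.Relation.Unary.All using (All; []; _∷_)
open import Function using (id)
open import Function.Bundles using (mk⇔)
open import Relation.Nullary using (¬_; Dec; yes; no; does)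
open import Relation.Nullary.Decidable using (¬?; _×-dec_; does-≡; toSum)
open import Relation.Binary.PropositionalEquality
  using (_≡_; refl; sym; trans; cong; cong₂; module ≡-Reasoning)
open import Relation.Binary.Structures using (IsEquivalence)
open import Axiom.ExcludedMiddle using (ExcludedMiddle)
open import Axiom.DoubleNegationElimination using (em⇒dne)

module _ {S : Set} (τ : Topology S) where
  open Topology τ

  open-if-neighbourhood-of-points : ∀ {A : Subset S} →
    (∀ s → A s → Σ (Subset S) λ V → Open V × V s × (∀ t → V t → A t)) →
    Open A
  open-if-neighbourhood-of-points {A} nbhd =
    open-ext (open-⋃ {I = Σ S A} (λ { (s , a) → proj₁ (nbhd s a) })
                                 (λ { (s , a) → proj₁ (proj₂ (nbhd s a)) }))
             (λ t → mk⇔ (λ { ((s , a) , v) → proj₂ (proj₂ (proj₂ (nbhd s a))) t v })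
                        (λ a → (t , a) , proj₁ (proj₂ (proj₂ (nbhd t a)))))

  open-⊎ : ∀ {U V : Subset S} → Open U → Open V → Open (λ s → U s ⊎ V s)
  open-⊎ {U} {V} oU oV =
    open-ext (open-⋃ {I = Bool} pick (λ { true → oU ; false → oV }))
             (λ s → mk⇔ (λ { (true , u) → inj₁ u ; (false , v) → inj₂ v })
                        (λ { (inj₁ u) → true , u ; (inj₂ v) → false , v }))
    where
      pick : Bool → Subset S
      pick true  = U
      pick false = V

  module _ {_~_ : S → S → Set} {U : Subset S} (oU : Open U) where

    box-open : UpperHemiContinuous τ _~_ → Open (λ d → ∀ e → d ~ e → U e)
    box-open uhc = open-if-neighbourhood-of-points (λ d → uhc d U oU)

    diamond-open : LowerHemiContinuous τ _~_ → Open (λ d → Σ S λ e → d ~ e × U e)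
    diamond-open lhc = open-if-neighbourhood-of-points (λ d → lhc d U oU)

-- Everything below uses excluded middle: truth sets are decided pointwise,
-- and complements of boxes, intersections and implications are classical.
module Classical (em : ExcludedMiddle 0ℓ) where

  dne : ∀ {P : Set} → ¬ ¬ P → P
  dne = em⇒dne em

  not-all⇒exists-not : ∀ {S : Set} {R A : Subset S} →
                       ¬ (∀ t → R t → A t) → Σ S λ t → R t × ¬ A t
  not-all⇒exists-not no-box =
    dne (λ no-witness → no-box (λ t r → dne (λ na → no-witness (t , r , na))))

  module _ {S : Set} (τ : Topology S) where
    open Topology τ

    clopen-¬ : ∀ {A : Subset S} → Clopen τ A → Clopen τ (λ s → ¬ A s)
    clopen-¬ (oA , cA) = cA , open-ext oA (λ s → mk⇔ (λ a na → na a) dne)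

    clopen-× : ∀ {A B : Subset S} → Clopen τ A → Clopen τ B →
               Clopen τ (λ s → A s × B s)
    clopen-× {A} {B} (oA , cA) (oB , cB) =
      open-∩ oA oB ,
      open-ext (open-⊎ τ cA cB)
               (λ s → mk⇔ (λ { (inj₁ na) (a , _) → na a ; (inj₂ nb) (_ , b) → nb b })
                          de-morgan)
      where
        de-morgan : ∀ {s} → ¬ (A s × B s) → ¬ A s ⊎ ¬ B s
        de-morgan {s} nab with em {A s}
        ... | yes a  = inj₂ (λ b → nab (a , b))
        ... | no  na = inj₁ na

  module _ {n m : ℕ} (𝒦 : Kripke n m) where
    open Kripke 𝒦

    module Block (j : Fin m) = IsEquivalence (isEq j)

    ⇒-intro : ∀ {f g s} → (α 𝒦 f s → α 𝒦 g s) → α 𝒦 (f ⇒ g) s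
    ⇒-intro h (a , ng) = ng (h a)

    ⇒-elim : ∀ {f g s} → α 𝒦 (f ⇒ g) s → α 𝒦 f s → α 𝒦 g s
    ⇒-elim h a = dne (λ ng → h (a , ng))

    truth : S → Formula n m → Bool
    truth s g = does (em {α 𝒦 g s})

    tval-truth : ∀ s f → tval (truth s) f ≡ truth s f
    tval-truth s (var x)   = refl
    tval-truth s (K j f)   = refl
    tval-truth s (neg f)   = begin
      not (tval (truth s) f)       ≡⟨ cong not (tval-truth s f) ⟩
      does (¬? (em {α 𝒦 f s}))     ≡⟨ does-≡ (¬? em) em ⟩
      truth s (neg f)              ∎
      where open ≡-Reasoning
    tval-truth s (f and g) = begin
      tval (truth s) f ∧ tval (truth s) g   ≡⟨ cong₂ _∧_ (tval-truth s f) (tval-truth s g) ⟩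
      does (em {α 𝒦 f s} ×-dec em)           ≡⟨ does-≡ (em ×-dec em) em ⟩
      truth s (f and g)                     ∎
      where open ≡-Reasoning

    tautology-holds : ∀ {f} → Tautology f → ∀ s → α 𝒦 f s
    tautology-holds {f} t s =
      holds-if-true em (trans (sym (tval-truth s f)) (t (truth s)))
      where
        holds-if-true : ∀ {P : Set} (p? : Dec P) → does p? ≡ true → P
        holds-if-true (yes p) _ = p
        holds-if-true (no _) ()

    sound : ∀ {f} → ⊢ f → ∀ s → α 𝒦 f s
    sound (taut t) = tautology-holds t
    sound (axK {j} {f} {g}) s =
      ⇒-intro {K j f and K j (f ⇒ g)} {K j g}
        (λ { (kf , kfg) t st → ⇒-elim {f} {g} (kfg t st) (kf t st) })
    sound (axT {j} {f}) s = ⇒-intro {K j f} {f} (λ kf → kf s (Block.refl j))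
    sound (ax4 {j} {f}) s =
      ⇒-intro {K j f} {K j (K j f)} (λ kf t st u tu → kf u (Block.trans j st tu))
    sound (ax5 {j} {f}) s =
      ⇒-intro {neg (K j f)} {K j (neg (K j f))}
        (λ nkf t st kft → nkf (λ u su → kft u (Block.trans j (Block.sym j st) su)))
    sound (mp p q) s = ⇒-elim (sound q s) (sound p s)
    sound (nec p) s t _ = sound p t


    conj-holds : ∀ {s} f fs → α 𝒦 f s → All (λ g → α 𝒦 g s) fs → α 𝒦 (conj f fs) s
    conj-holds f []       a []       = a
    conj-holds f (g ∷ gs) a (b ∷ bs) = a , conj-holds g gs b bs

    φ : S → Ω n m
    φ s = (λ f → α 𝒦 f s) , (λ f → toSum em) , consistent
      where
        consistent : Consistent (λ f → α 𝒦 f s)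
        consistent f fs a as ⊢¬conj = sound ⊢¬conj s (conj-holds f fs a as)

    φ-canonical : IsCanonicalMap 𝒦 φ
    φ-canonical s f = mk⇔ id id

    module _ (τ : Topology S)
             (ψ-fibre-clopen : ∀ (a : Fin n → Bool) → Clopen τ (ψ⁻¹ 𝒦 a))
             (hemi : ∀ (j : Fin m) → UpperHemiContinuous τ (λ s t → s ∼[ j ] t)
                                   × LowerHemiContinuous τ (λ s t → s ∼[ j ] t)) where
      open Topology τ

      -- A union of fibres of ψ is open: s lies in its open fibre ψ⁻¹(ψ s).
      ψ-saturated-open : ∀ {A : Subset S} →
                         (∀ s t → ψ⁻¹ 𝒦 (ψ s) t → A s → A t) → Open A
      ψ-saturated-open saturated = open-if-neighbourhood-of-points τ
        (λ s a → ψ⁻¹ 𝒦 (ψ s) , proj₁ (ψ-fibre-clopen (ψ s)) , (λ _ → refl) ,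
                 (λ t same-fibre → saturated s t same-fibre a))

      α-clopen : ∀ f → Clopen τ (α 𝒦 f)
      α-clopen (var x)   =
        ψ-saturated-open (λ s t same holds → trans (same x) holds) ,
        ψ-saturated-open (λ s t same fails holds → fails (trans (sym (same x)) holds))
      α-clopen (neg f)   = clopen-¬ τ (α-clopen f)
      α-clopen (f and g) = clopen-× τ (α-clopen f) (α-clopen g)
      α-clopen (K j f)   =
        box-open τ (proj₁ (α-clopen f)) (proj₁ (hemi j)) ,
        open-ext (diamond-open τ (proj₂ (α-clopen f)) (proj₂ (hemi j)))
                 (λ s → mk⇔ (λ { (t , st , fails) knows → fails (knows t st) })
                            not-all⇒exists-not)

      -- The preimage of the basic open set {z | f ∈ z} is the open set α(f),
      -- so the preimage of any open set is a union of open sets.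
      φ-continuous : Continuous 𝒦 τ φ
      φ-continuous U open-U = open-if-neighbourhood-of-points τ λ s in-U →
        let (f , f∈φs , basic⊆U) = open-U (φ s) in-U
        in α 𝒦 f , proj₁ (α-clopen f) , f∈φs , (λ t holds → basic⊆U (φ t) holds)

lemma1 : ExcludedMiddle 0ℓ →
         (n m : ℕ) (𝒦 : Kripke n m) (τ : Topology (Kripke.S 𝒦)) →
         (∀ (a : Fin n → Bool) → Clopen τ (ψ⁻¹ 𝒦 a)) →
         (∀ (j : Fin m) → UpperHemiContinuous τ (λ s t → Kripke._∼[_]_ 𝒦 s j t)
                        × LowerHemiContinuous τ (λ s t → Kripke._∼[_]_ 𝒦 s j t)) →
         Σ (Kripke.S 𝒦 → Ω n m) λ φ → IsCanonicalMap 𝒦 φ × Continuous 𝒦 τ φ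
lemma1 em n m 𝒦 τ ψ-fibre-clopen hemi =
  φ 𝒦 , φ-canonical 𝒦 , φ-continuous 𝒦 τ ψ-fibre-clopen hemi
  where open Classical em
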